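{- Let $\lambda\in\mathbb{R}$, let $\alpha$ be a positive integer, let $m\in\mathbb{N}$ with $m\ge \alpha$, and let $a_1,a_2,\dots,a_m$ be any (complex) sequence. Then \[ \sum_{k=\alpha}^{m}(k)_{\alpha,\lambda}\,a_{k}=\sum_{k=1}^{m}S_{2,\lambda}(\alpha,k)\,k!\sum_{l=k}^{m}\binom{l}{k}a_{l}\;-\;\sum_{k=1}^{\alpha-1}S_{2,\lambda}(\alpha,k)\,k!\sum_{l=k}^{\alpha-1}\binom{l}{k}a_{l}. \]
   Context: For $\lambda\in\mathbb{R}$, the generalized falling factorial polynomials are $(x)_{0,\lambda}=1$ and $(x)_{n,\lambda}=x(x-\lambda)(x-2\lambda)\cdots(x-(n-1)\lambda)$ for $n\ge1$. The ordinary falling factorial is $(x)_0=1$, $(x)_n=x(x-1)\cdots(x-n+1)$ for $n\ge 1$. The degenerate Stirling numbers of the second kind $S_{2,\lambda}(n,k)$ ($0\le k\le n$) are defined by $(x)_{n,\lambda}=\sum_{k=0}^{n}S_{2,\lambda}(n,k)(x)_{k}$ for all $n\ge 0$, with $S_{2,\lambda}(n,k)=0$ for $k>n$ or $k<0$. -}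

module Defs where

open import Level using (Level)
open import Algebra.Bundles using (CommutativeRing)
open import Data.Nat as ℕ using (ℕ; zero; suc; _<_; _≤_; _∸_)
open import Data.Nat.Combinatorics using (_C_)
open import Data.Nat using (_!)
open import Data.List using (List; map; foldr; upTo)
open import Data.Product using (_×_)

module _ {c ℓ : Level} (R : CommutativeRing c ℓ) where
  open CommutativeRing R

  ι : ℕ → Carrier
  ι zero    = 0#
  ι (suc n) = 1# + ι n

  -- Σ_{k=a}^{b} f k  (empty, i.e. 0, when b < a)
  ∑[_⋯_] : ℕ → ℕ → (ℕ → Carrier) → Carrier
  ∑[ a ⋯ b ] f = foldr _+_ 0# (map (λ i → f (a ℕ.+ i)) (upTo (suc b ∸ a)))

  fallλ : Carrier → Carrier → ℕ → Carrier
  fallλ lam x zero    = 1#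
  fallλ lam x (suc n) = fallλ lam x n * (x - ι n * lam)

  fall : Carrier → ℕ → Carrier
  fall x zero    = 1#
  fall x (suc n) = fall x n * (x - ι n)

  IsDegStirling2 : Carrier → (ℕ → ℕ → Carrier) → Set _
  IsDegStirling2 lam S =
    (∀ (n : ℕ) (x : Carrier) → fallλ lam x n ≈ ∑[ 0 ⋯ n ] (λ k → S n k * fall x k))
    × (∀ (n k : ℕ) → n < k → S n k ≈ 0#)

-- Since k! C(l,k) = (l)_k, exchanging the order of summation turns
--   Σ_{k=1}^{m} S_{2,λ}(α,k) k! Σ_{l=k}^{m} C(l,k) a_l
-- into Σ_{l=1}^{m} a_l Σ_{k=1}^{l} S_{2,λ}(α,k) (l)_k = Σ_{l=1}^{m} (l)_{α,λ} a_l;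
-- the inner sum may run up to l rather than α because (l)_k = 0 for k > l and
-- S_{2,λ}(α,k) = 0 for k > α, and the term k = 0 drops out since (0)_{α,λ} = 0.
-- The right-hand side is thus Σ_{l=1}^{m} (l)_{α,λ} a_l − Σ_{l=1}^{α-1} (l)_{α,λ} a_l.
module Submission where

open import Defs
open import Level using (Level)
open import Algebra.Bundles using (CommutativeRing)
open import Data.Nat using (ℕ; _≤_; _∸_; _!)
open import Data.Nat.Combinatorics using (_C_)
open import Data.Nat as ℕ using (zero; suc; _<_; z≤n; s≤s; _≤′_; ≤′-refl; ≤′-step; NonZero)
open import Data.Nat.Properties
  using ( _<?_; _≤?_; _!≢0; <⇒≤; ≤-pred; ≤-trans; n<1+n; ≮⇒≥; ≰⇒>; ≤⇒≤′; ≤′⇒≤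
        ; m≤m+n; m≤n+m; m<n⇒n≢0; m∸n≢0⇒n<m; m≤n⇒m∸n≡0; m≤o∸n⇒m+n≤o; +-∸-assoc
        ; m+[n∸m]≡n; m≤n⇒m<n∨m≡n)
import Data.Nat.Properties as ℕₚ
open import Data.Nat.Combinatorics using (_P_; nCk≡nPk/k!; nPk≡n!/[n∸k]!; k>n⇒nCk≡0)
open import Data.Nat.Combinatorics.Base using (_P′_)
open import Data.Nat.Combinatorics.Specification using (nP′k≡n!/[n∸k]!; k!∣nP′k)
open import Data.Nat.DivMod using (_/_; m*[n/m]≡n)
open import Data.List using (List; []; _∷_; _++_; [_]; map; foldr; upTo)
open import Data.List.Properties using (upTo-∷ʳ)
open import Data.List.Membership.Propositional using (_∈_)
open import Data.List.Membership.Propositional.Properties using (∈-upTo⁻)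
open import Data.List.Relation.Unary.Any using (here; there)
open import Data.Product using (proj₁; proj₂)
open import Data.Sum using (inj₁; inj₂)
open import Relation.Nullary using (yes; no; contradiction)
open import Relation.Binary.PropositionalEquality as ≡ using (_≡_)
import Algebra.Properties.AbelianGroup as AbelianGroupProperties
import Algebra.Properties.CommutativeSemigroup as CommutativeSemigroupProperties
import Algebra.Properties.Semiring.Mult as SemiringMult
import Relation.Binary.Reasoning.Setoid as SetoidReasoning

nPk≡nP′k : ∀ {n k} → k ≤ n → n P k ≡ n P′ k
nPk≡nP′k k≤n = ≡.trans (nPk≡n!/[n∸k]! k≤n) (≡.sym (nP′k≡n!/[n∸k]! k≤n))

k!*nCk≡nP′k : ∀ {n k} → k ≤ n → k ! ℕ.* (n C k) ≡ n P′ k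
k!*nCk≡nP′k {n} {k} k≤n = begin
  k ! ℕ.* (n C k)              ≡⟨ ≡.cong (k ! ℕ.*_) (nCk≡nPk/k! k≤n) ⟩
  k ! ℕ.* ((n P k) / k !)      ≡⟨ ≡.cong (λ p → k ! ℕ.* (p / k !)) (nPk≡nP′k k≤n) ⟩
  k ! ℕ.* ((n P′ k) / k !)     ≡⟨ m*[n/m]≡n (k!∣nP′k k≤n) ⟩
  n P′ k                       ∎
  where
  open ≡.≡-Reasoning
  instance
    k!≢0 : NonZero (k !)
    k!≢0 = k !≢0

i<n∸m⇒m+i<n : ∀ {m n i} → i < n ∸ m → m ℕ.+ i < n
i<n∸m⇒m+i<n {m} {n} {i} i<n∸m =
  ≡.subst (_≤ n) (≡.cong suc (ℕₚ.+-comm i m)) (m≤o∸n⇒m+n≤o (suc i) m≤n i<n∸m)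
  where
  m≤n : m ≤ n
  m≤n = <⇒≤ (m∸n≢0⇒n<m (m<n⇒n≢0 i<n∸m))

module _ {r ℓ : Level} (R : CommutativeRing r ℓ) where
  open CommutativeRing R
  open SetoidReasoning setoid
  open SemiringMult semiring using (_×_; ×-homo-+; ×1-homo-*)
  open AbelianGroupProperties +-abelianGroup using (xyx⁻¹≈y)
  open CommutativeSemigroupProperties +-commutativeSemigroup using (interchange)

  ∑ᴸ : List ℕ → (ℕ → Carrier) → Carrier
  ∑ᴸ xs f = foldr _+_ 0# (map f xs)

  ∑ᴸ-cong : ∀ xs {f g} → (∀ {i} → i ∈ xs → f i ≈ g i) → ∑ᴸ xs f ≈ ∑ᴸ xs g
  ∑ᴸ-cong []       f≈g = refl
  ∑ᴸ-cong (x ∷ xs) f≈g = +-cong (f≈g (here ≡.refl)) (∑ᴸ-cong xs (λ i∈xs → f≈g (there i∈xs)))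

  ∑ᴸ-zero : ∀ xs {f} → (∀ {i} → i ∈ xs → f i ≈ 0#) → ∑ᴸ xs f ≈ 0#
  ∑ᴸ-zero []       f≈0 = refl
  ∑ᴸ-zero (x ∷ xs) f≈0 =
    trans (+-cong (f≈0 (here ≡.refl)) (∑ᴸ-zero xs (λ i∈xs → f≈0 (there i∈xs)))) (+-identityʳ 0#)

  ∑ᴸ-+ : ∀ xs f g → ∑ᴸ xs (λ i → f i + g i) ≈ ∑ᴸ xs f + ∑ᴸ xs g
  ∑ᴸ-+ []       f g = sym (+-identityʳ 0#)
  ∑ᴸ-+ (x ∷ xs) f g = trans (+-congˡ (∑ᴸ-+ xs f g)) (interchange _ _ _ _)

  ∑ᴸ-*ˡ : ∀ xs x f → x * ∑ᴸ xs f ≈ ∑ᴸ xs (λ i → x * f i)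
  ∑ᴸ-*ˡ []       x f = zeroʳ x
  ∑ᴸ-*ˡ (y ∷ xs) x f = trans (distribˡ x _ _) (+-congˡ (∑ᴸ-*ˡ xs x f))

  ∑ᴸ-*ʳ : ∀ xs x f → ∑ᴸ xs f * x ≈ ∑ᴸ xs (λ i → f i * x)
  ∑ᴸ-*ʳ []       x f = zeroˡ x
  ∑ᴸ-*ʳ (y ∷ xs) x f = trans (distribʳ x _ _) (+-congˡ (∑ᴸ-*ʳ xs x f))

  ∑ᴸ-++ : ∀ xs ys f → ∑ᴸ (xs ++ ys) f ≈ ∑ᴸ xs f + ∑ᴸ ys f
  ∑ᴸ-++ []       ys f = sym (+-identityˡ _)
  ∑ᴸ-++ (x ∷ xs) ys f = trans (+-congˡ (∑ᴸ-++ xs ys f)) (sym (+-assoc _ _ _))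

  ∑ : ℕ → ℕ → (ℕ → Carrier) → Carrier
  ∑ = ∑[_⋯_] R

  ∑-cong : ∀ a b {f g} → (∀ i → a ≤ i → i ≤ b → f i ≈ g i) → ∑ a b f ≈ ∑ a b g
  ∑-cong a b f≈g = ∑ᴸ-cong (upTo (suc b ∸ a)) λ {i} i∈ →
    f≈g (a ℕ.+ i) (m≤m+n a i) (≤-pred (i<n∸m⇒m+i<n (∈-upTo⁻ i∈)))

  ∑-zero : ∀ a b {f} → (∀ i → a ≤ i → i ≤ b → f i ≈ 0#) → ∑ a b f ≈ 0#
  ∑-zero a b f≈0 = ∑ᴸ-zero (upTo (suc b ∸ a)) λ {i} i∈ →
    f≈0 (a ℕ.+ i) (m≤m+n a i) (≤-pred (i<n∸m⇒m+i<n (∈-upTo⁻ i∈)))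

  ∑-+ : ∀ a b f g → ∑ a b (λ i → f i + g i) ≈ ∑ a b f + ∑ a b g
  ∑-+ a b f g = ∑ᴸ-+ (upTo (suc b ∸ a)) _ _

  ∑-*ˡ : ∀ a b x f → x * ∑ a b f ≈ ∑ a b (λ i → x * f i)
  ∑-*ˡ a b x f = ∑ᴸ-*ˡ (upTo (suc b ∸ a)) x _

  ∑-*ʳ : ∀ a b x f → ∑ a b f * x ≈ ∑ a b (λ i → f i * x)
  ∑-*ʳ a b x f = ∑ᴸ-*ʳ (upTo (suc b ∸ a)) x _

  ∑-empty : ∀ a b f → b < a → ∑ a b f ≈ 0#
  ∑-empty a b f b<a = reflexive (≡.cong (λ n → ∑ᴸ (upTo n) (λ i → f (a ℕ.+ i))) (m≤n⇒m∸n≡0 b<a))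

  ∑-snoc : ∀ a b f → a ≤ suc b → ∑ a (suc b) f ≈ ∑ a b f + f (suc b)
  ∑-snoc a b f a≤1+b = begin
    ∑ᴸ (upTo (suc (suc b) ∸ a)) g       ≡⟨ ≡.cong (λ n → ∑ᴸ (upTo n) g) (+-∸-assoc 1 a≤1+b) ⟩
    ∑ᴸ (upTo (suc n)) g                 ≡⟨ ≡.cong (λ xs → ∑ᴸ xs g) (≡.sym (upTo-∷ʳ n)) ⟩
    ∑ᴸ (upTo n ++ [ n ]) g              ≈⟨ ∑ᴸ-++ (upTo n) [ n ] g ⟩
    ∑ᴸ (upTo n) g + (g n + 0#)          ≈⟨ +-congˡ (+-identityʳ (g n)) ⟩
    ∑ a b f + f (a ℕ.+ n)               ≡⟨ ≡.cong (λ i → ∑ a b f + f i) (m+[n∸m]≡n a≤1+b) ⟩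
    ∑ a b f + f (suc b)                 ∎
    where
    n : ℕ
    n = suc b ∸ a
    g : ℕ → Carrier
    g i = f (a ℕ.+ i)

  ∑-split : ∀ a b c f → a ≤ suc b → b ≤ c → ∑ a c f ≈ ∑ a b f + ∑ (suc b) c f
  ∑-split a b c f a≤1+b b≤c = go (≤⇒≤′ b≤c)
    where
    go : ∀ {c} → b ≤′ c → ∑ a c f ≈ ∑ a b f + ∑ (suc b) c f
    go ≤′-refl = sym (trans (+-congˡ (∑-empty (suc b) b f (n<1+n b))) (+-identityʳ _))
    go {suc c} (≤′-step b≤′c) = begin
      ∑ a (suc c) f                          ≈⟨ ∑-snoc a c f (≤-trans a≤1+b (s≤s (≤′⇒≤ b≤′c))) ⟩
      ∑ a c f + f (suc c)                    ≈⟨ +-congʳ (go b≤′c) ⟩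
      (∑ a b f + ∑ (suc b) c f) + f (suc c)  ≈⟨ +-assoc _ _ _ ⟩
      ∑ a b f + (∑ (suc b) c f + f (suc c))  ≈⟨ +-congˡ (∑-snoc (suc b) c f (s≤s (≤′⇒≤ b≤′c))) ⟨
      ∑ a b f + ∑ (suc b) (suc c) f          ∎

  ∑-extend : ∀ a b c f → (∀ i → b < i → f i ≈ 0#) → a ≤ suc b → b ≤ c → ∑ a c f ≈ ∑ a b f
  ∑-extend a b c f f≈0 a≤1+b b≤c = begin
    ∑ a c f                    ≈⟨ ∑-split a b c f a≤1+b b≤c ⟩
    ∑ a b f + ∑ (suc b) c f    ≈⟨ +-congˡ (∑-zero (suc b) c (λ i b<i _ → f≈0 i b<i)) ⟩
    ∑ a b f + 0#               ≈⟨ +-identityʳ _ ⟩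
    ∑ a b f                    ∎

  ∑-triangle-swap : ∀ a m (f : ℕ → ℕ → Carrier) →
    ∑ a m (λ k → ∑ k m (f k)) ≈ ∑ a m (λ l → ∑ a l (λ k → f k l))
  ∑-triangle-swap a m f with m <? a
  ... | yes m<a = trans (∑-empty a m (λ k → ∑ k m (f k)) m<a)
                        (sym (∑-empty a m (λ l → ∑ a l (λ k → f k l)) m<a))
  ∑-triangle-swap zero    zero    f | no _    = refl
  ∑-triangle-swap (suc a) zero    f | no 0≮1+a = contradiction (s≤s z≤n) 0≮1+a
  ∑-triangle-swap a       (suc m) f | no m≮a = begin
    ∑ a (suc m) (λ k → ∑ k (suc m) (f k))
      ≈⟨ ∑-cong a (suc m) {g = λ k → ∑ k m (f k) + f k (suc m)}
                (λ k _ k≤1+m → ∑-snoc k m (f k) k≤1+m) ⟩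
    ∑ a (suc m) (λ k → ∑ k m (f k) + f k (suc m))
      ≈⟨ ∑-+ a (suc m) (λ k → ∑ k m (f k)) (λ k → f k (suc m)) ⟩
    ∑ a (suc m) (λ k → ∑ k m (f k)) + ∑ a (suc m) (λ k → f k (suc m))
      ≈⟨ +-congʳ (∑-snoc a m (λ k → ∑ k m (f k)) a≤1+m) ⟩
    (∑ a m (λ k → ∑ k m (f k)) + ∑ (suc m) m (f (suc m))) + ∑ a (suc m) (λ k → f k (suc m))
      ≈⟨ +-congʳ (trans (+-congˡ (∑-empty (suc m) m (f (suc m)) (n<1+n m))) (+-identityʳ _)) ⟩
    ∑ a m (λ k → ∑ k m (f k)) + ∑ a (suc m) (λ k → f k (suc m))
      ≈⟨ +-congʳ (∑-triangle-swap a m f) ⟩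
    ∑ a m (λ l → ∑ a l (λ k → f k l)) + ∑ a (suc m) (λ k → f k (suc m))
      ≈⟨ ∑-snoc a m (λ l → ∑ a l (λ k → f k l)) a≤1+m ⟨
    ∑ a (suc m) (λ l → ∑ a l (λ k → f k l))
      ∎
    where
    a≤1+m : a ≤ suc m
    a≤1+m = ≮⇒≥ m≮a

  ι≡×1# : ∀ n → ι R n ≡ n × 1#
  ι≡×1# zero    = ≡.refl
  ι≡×1# (suc n) = ≡.cong (1# +_) (ι≡×1# n)

  ι-+ : ∀ m n → ι R (m ℕ.+ n) ≈ ι R m + ι R n
  ι-+ m n = begin
    ι R (m ℕ.+ n)            ≡⟨ ι≡×1# (m ℕ.+ n) ⟩
    (m ℕ.+ n) × 1#           ≈⟨ ×-homo-+ 1# m n ⟩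
    m × 1# + n × 1#          ≡⟨ ≡.cong₂ _+_ (ι≡×1# m) (ι≡×1# n) ⟨
    ι R m + ι R n            ∎

  ι-* : ∀ m n → ι R (m ℕ.* n) ≈ ι R m * ι R n
  ι-* m n = begin
    ι R (m ℕ.* n)            ≡⟨ ι≡×1# (m ℕ.* n) ⟩
    (m ℕ.* n) × 1#           ≈⟨ ×1-homo-* m n ⟩
    (m × 1#) * (n × 1#)      ≡⟨ ≡.cong₂ _*_ (ι≡×1# m) (ι≡×1# n) ⟨
    ι R m * ι R n            ∎

  ι-∸ : ∀ {n k} → k ≤ n → ι R n - ι R k ≈ ι R (n ∸ k)
  ι-∸ {n} {k} k≤n = begin
    ι R n - ι R k                         ≡⟨ ≡.cong (λ i → ι R i - ι R k) (m+[n∸m]≡n k≤n) ⟨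
    ι R (k ℕ.+ (n ∸ k)) - ι R k           ≈⟨ +-congʳ (ι-+ k (n ∸ k)) ⟩
    ι R k + ι R (n ∸ k) - ι R k           ≈⟨ xyx⁻¹≈y (ι R k) (ι R (n ∸ k)) ⟩
    ι R (n ∸ k)                           ∎

  fall-ι≈P′ : ∀ {n k} → k ≤ n → fall R (ι R n) k ≈ ι R (n P′ k)
  fall-ι≈P′ {n} {zero}  _   = sym (+-identityʳ 1#)
  fall-ι≈P′ {n} {suc k} k<n = begin
    fall R (ι R n) k * (ι R n - ι R k)    ≈⟨ *-cong (fall-ι≈P′ (<⇒≤ k<n)) (ι-∸ (<⇒≤ k<n)) ⟩
    ι R (n P′ k) * ι R (n ∸ k)            ≈⟨ ι-* (n P′ k) (n ∸ k) ⟨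
    ι R ((n P′ k) ℕ.* (n ∸ k))            ≡⟨ ≡.cong (ι R) (ℕₚ.*-comm (n P′ k) (n ∸ k)) ⟩
    ι R ((n ∸ k) ℕ.* (n P′ k))            ∎

  fall-ι-vanish : ∀ {n k} → n < k → fall R (ι R n) k ≈ 0#
  fall-ι-vanish {n} {suc k} n<1+k with m≤n⇒m<n∨m≡n (≤-pred n<1+k)
  ... | inj₁ n<k     = trans (*-congʳ (fall-ι-vanish n<k)) (zeroˡ _)
  ... | inj₂ ≡.refl  = trans (*-congˡ (-‿inverseʳ (ι R n))) (zeroʳ _)

  fall-ι : ∀ n k → fall R (ι R n) k ≈ ι R (k !) * ι R (n C k)
  fall-ι n k with k ≤? n
  ... | yes k≤n = begin
    fall R (ι R n) k          ≈⟨ fall-ι≈P′ k≤n ⟩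
    ι R (n P′ k)              ≡⟨ ≡.cong (ι R) (k!*nCk≡nP′k k≤n) ⟨
    ι R (k ! ℕ.* (n C k))     ≈⟨ ι-* (k !) (n C k) ⟩
    ι R (k !) * ι R (n C k)   ∎
  ... | no k≰n = begin
    fall R (ι R n) k          ≈⟨ fall-ι-vanish (≰⇒> k≰n) ⟩
    0#                        ≈⟨ zeroʳ (ι R (k !)) ⟨
    ι R (k !) * ι R 0         ≡⟨ ≡.cong (λ i → ι R (k !) * ι R i) (k>n⇒nCk≡0 (≰⇒> k≰n)) ⟨
    ι R (k !) * ι R (n C k)   ∎

  fallλ-zero : ∀ lam n → fallλ R lam 0# (suc n) ≈ 0#
  fallλ-zero lam zero    =
    trans (*-congˡ (trans (+-congˡ (-‿cong (zeroˡ lam))) (-‿inverseʳ 0#))) (zeroʳ _)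
  fallλ-zero lam (suc n) = trans (*-congʳ (fallλ-zero lam n)) (zeroˡ _)

  module _ {lam : Carrier} {S : ℕ → ℕ → Carrier} (isStirling : IsDegStirling2 R lam S) where
    private
      fallλ≈∑S*fall : ∀ n x → fallλ R lam x n ≈ ∑ 0 n (λ k → S n k * fall R x k)
      fallλ≈∑S*fall = proj₁ isStirling
      S-vanish : ∀ n k → n < k → S n k ≈ 0#
      S-vanish = proj₂ isStirling

    fallλ-ι≈∑S*fall : ∀ α n → ∑ 0 n (λ k → S α k * fall R (ι R n) k) ≈ fallλ R lam (ι R n) α
    fallλ-ι≈∑S*fall α n = begin
      ∑ 0 n g             ≈⟨ ∑-extend 0 n (n ℕ.+ α) g beyond-n z≤n (m≤m+n n α) ⟨
      ∑ 0 (n ℕ.+ α) g     ≈⟨ ∑-extend 0 α (n ℕ.+ α) g beyond-α z≤n (m≤n+m α n) ⟩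
      ∑ 0 α g             ≈⟨ fallλ≈∑S*fall α (ι R n) ⟨
      fallλ R lam (ι R n) α ∎
      where
      g : ℕ → Carrier
      g k = S α k * fall R (ι R n) k
      beyond-n : ∀ k → n < k → g k ≈ 0#
      beyond-n k n<k = trans (*-congˡ (fall-ι-vanish n<k)) (zeroʳ _)
      beyond-α : ∀ k → α < k → g k ≈ 0#
      beyond-α k α<k = trans (*-congʳ (S-vanish α k α<k)) (zeroˡ _)

    S-at-0 : ∀ β → S (suc β) 0 ≈ 0#
    S-at-0 β = begin
      S (suc β) 0                 ≈⟨ *-identityʳ _ ⟨
      S (suc β) 0 * 1#            ≈⟨ +-identityʳ _ ⟨
      S (suc β) 0 * 1# + 0#       ≈⟨ fallλ-ι≈∑S*fall (suc β) 0 ⟩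
      fallλ R lam 0# (suc β)      ≈⟨ fallλ-zero lam β ⟩
      0#                          ∎

    fallλ-ι≈∑S*binomial : ∀ β l →
      ∑ 1 l (λ k → S (suc β) k * ι R (k !) * ι R (l C k)) ≈ fallλ R lam (ι R l) (suc β)
    fallλ-ι≈∑S*binomial β l = begin
      ∑ 1 l (λ k → S α k * ι R (k !) * ι R (l C k))
        ≈⟨ ∑-cong 1 l {g = g} (λ k _ _ → trans (*-assoc _ _ _) (*-congˡ (sym (fall-ι l k)))) ⟩
      ∑ 1 l g                 ≈⟨ +-identityˡ _ ⟨
      0# + ∑ 1 l g            ≈⟨ +-congʳ (trans (+-identityʳ _) (trans (*-congʳ (S-at-0 β)) (zeroˡ _))) ⟨
      g 0 + 0# + ∑ 1 l g      ≈⟨ ∑-split 0 0 l g z≤n z≤n ⟨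
      ∑ 0 l g                 ≈⟨ fallλ-ι≈∑S*fall α l ⟩
      fallλ R lam (ι R l) α   ∎
      where
      α : ℕ
      α = suc β
      g : ℕ → Carrier
      g k = S α k * fall R (ι R l) k

    ∑S*k!*∑C≈∑fallλ : ∀ β m (a : ℕ → Carrier) →
      ∑ 1 m (λ k → S (suc β) k * ι R (k !) * ∑ k m (λ l → ι R (l C k) * a l))
        ≈ ∑ 1 m (λ l → fallλ R lam (ι R l) (suc β) * a l)
    ∑S*k!*∑C≈∑fallλ β m a = begin
      ∑ 1 m (λ k → c k * ∑ k m (λ l → ι R (l C k) * a l))
        ≈⟨ ∑-cong 1 m (λ k _ _ → ∑-*ˡ k m (c k) (λ l → ι R (l C k) * a l)) ⟩
      ∑ 1 m (λ k → ∑ k m (λ l → c k * (ι R (l C k) * a l)))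
        ≈⟨ ∑-triangle-swap 1 m (λ k l → c k * (ι R (l C k) * a l)) ⟩
      ∑ 1 m (λ l → ∑ 1 l (λ k → c k * (ι R (l C k) * a l)))
        ≈⟨ ∑-cong 1 m (λ l _ _ →
             ∑-cong 1 l {g = λ k → c k * ι R (l C k) * a l} (λ k _ _ → sym (*-assoc _ _ _))) ⟩
      ∑ 1 m (λ l → ∑ 1 l (λ k → c k * ι R (l C k) * a l))
        ≈⟨ ∑-cong 1 m {g = F} (λ l _ _ → trans (sym (∑-*ʳ 1 l (a l) (λ k → c k * ι R (l C k))))
                                               (*-congʳ (fallλ-ι≈∑S*binomial β l))) ⟩
      ∑ 1 m F
        ∎
      where
      c : ℕ → Carrier
      c k = S (suc β) k * ι R (k !)
      F : ℕ → Carrier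
      F l = fallλ R lam (ι R l) (suc β) * a l

theorem1 : ∀ {c ℓ : Level} (R : CommutativeRing c ℓ) →
    let open CommutativeRing R in
    (lam : Carrier) (S : ℕ → ℕ → Carrier) → IsDegStirling2 R lam S →
    (α m : ℕ) → 1 ≤ α → α ≤ m → (a : ℕ → Carrier) →
    ∑[_⋯_] R α m (λ k → fallλ R lam (ι R k) α * a k)
      ≈ ∑[_⋯_] R 1 m (λ k → S α k * ι R (k !) * ∑[_⋯_] R k m (λ l → ι R (l C k) * a l))
        - ∑[_⋯_] R 1 (α ∸ 1) (λ k → S α k * ι R (k !) * ∑[_⋯_] R k (α ∸ 1) (λ l → ι R (l C k) * a l))
theorem1 R lam S isStirling (suc β) m (s≤s z≤n) β<m a = sym (begin
  ∑ R 1 m (T m) - ∑ R 1 β (T β)                ≈⟨ +-cong (∑S*k!*∑C≈∑fallλ R isStirling β m a)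
                                                          (-‿cong (∑S*k!*∑C≈∑fallλ R isStirling β β a)) ⟩
  ∑ R 1 m F - ∑ R 1 β F                        ≈⟨ +-congʳ (∑-split R 1 β m F (s≤s z≤n) (<⇒≤ β<m)) ⟩
  ∑ R 1 β F + ∑ R (suc β) m F - ∑ R 1 β F      ≈⟨ xyx⁻¹≈y (∑ R 1 β F) _ ⟩
  ∑ R (suc β) m F                              ∎)
  where
  open CommutativeRing R
  open SetoidReasoning setoid
  open AbelianGroupProperties +-abelianGroup using (xyx⁻¹≈y)
  F : ℕ → Carrier
  F l = fallλ R lam (ι R l) (suc β) * a l
  T : ℕ → ℕ → Carrier
  T n k = S (suc β) k * ι R (k !) * ∑ R k n (λ l → ι R (l C k) * a l)
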